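{- Every actively structurally complete variety of positive S4-algebras contains neither $\mathbf{C}_3^a$ nor $\mathbf{C}_3^b$.
   Context: A positive S4-algebra is a structure $\langle A,\land,\lor,\Box,\Diamond,0,1\rangle$ such that $\langle A,\land,\lor,0,1\rangle$ is a bounded distributive lattice, $\Box 1=1$, $\Diamond 0=0$, and for all $a,b$: $\Box(a\land b)=\Box a\land\Box b$, $\Diamond(a\lor b)=\Diamond a\lor\Diamond b$, $\Box a\land\Diamond b\le\Diamond(a\land b)$, $\Box(a\lor b)\le\Box a\lor\Diamond b$, and $\Box\Box a=\Box a\le a\le\Diamond a=\Diamond\Diamond a$. $\mathbf{C}_3^a$: the chain $0<a<1$ with $0,1$ fixed by $\Box,\Diamond$, $\Box a=0$, $\Diamond a=a$. $\mathbf{C}_3^b$: the chain $0<a<1$ with $0,1$ fixed, $\Box a=a$, $\Diamond a=1$. For a variety $\mathsf{K}$, a quasi-equation $\varphi_1\approx\psi_1\,\&\dots\&\,\varphi_n\approx\psi_n\to\varphi\approx\psi$ is active if some substitution $\sigma$ makes all $\sigma\varphi_i\approx\sigma\psi_i$ identities of $\mathsf{K}$, and admissible if every such substitution also makes $\sigma\varphi\approx\sigma\psi$ an identity of $\mathsf{K}$; $\mathsf{K}$ is actively structurally complete if every active admissible quasi-equation is valid in $\mathsf{K}$. -}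

module Defs where

open import Level using (0ℓ)
open import Data.Nat using (ℕ)
open import Data.Product using (_×_; _,_; Σ; ∃)
open import Data.List using (List)
open import Data.List.Relation.Unary.All using (All)
open import Relation.Binary using (Rel)
open import Relation.Binary.PropositionalEquality using (_≡_)
open import Algebra.Core using (Op₁; Op₂)
import Algebra.Definitions as AD
import Algebra.Lattice.Structures as LS

record Alg : Set₁ where
  field
    Carrier : Set
    _≈_     : Rel Carrier 0ℓ
    _∧_ _∨_ : Op₂ Carrier
    □ ◇     : Op₁ Carrier
    𝟘 𝟙     : Carrier

record IsPosS4 (A : Alg) : Set where
  open Alg A
  _≤_ : Carrier → Carrier → Set
  a ≤ b = (a ∧ b) ≈ a
  field
    isDistributiveLattice : LS.IsDistributiveLattice _≈_ _∨_ _∧_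
    ∨-identity : AD.Identity _≈_ 𝟘 _∨_
    ∧-identity : AD.Identity _≈_ 𝟙 _∧_
    □-cong : AD.Congruent₁ _≈_ □
    ◇-cong : AD.Congruent₁ _≈_ ◇
    □-𝟙 : □ 𝟙 ≈ 𝟙
    ◇-𝟘 : ◇ 𝟘 ≈ 𝟘
    □-∧ : ∀ a b → □ (a ∧ b) ≈ (□ a ∧ □ b)
    ◇-∨ : ∀ a b → ◇ (a ∨ b) ≈ (◇ a ∨ ◇ b)
    □◇-∧ : ∀ a b → (□ a ∧ ◇ b) ≤ ◇ (a ∧ b)
    □◇-∨ : ∀ a b → □ (a ∨ b) ≤ (□ a ∨ ◇ b)
    □□ : ∀ a → □ (□ a) ≈ □ a
    □-≤ : ∀ a → □ a ≤ a
    ≤-◇ : ∀ a → a ≤ ◇ a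
    ◇◇ : ∀ a → ◇ (◇ a) ≈ ◇ a

data Term : Set where
  var    : ℕ → Term
  _∧ₜ_ _∨ₜ_ : Term → Term → Term
  □ₜ ◇ₜ  : Term → Term
  𝟘ₜ 𝟙ₜ  : Term

Equation : Set
Equation = Term × Term

module _ (A : Alg) where
  open Alg A
  ⟦_⟧ : Term → (ℕ → Carrier) → Carrier
  ⟦ var x ⟧ v = v x
  ⟦ s ∧ₜ t ⟧ v = ⟦ s ⟧ v ∧ ⟦ t ⟧ v
  ⟦ s ∨ₜ t ⟧ v = ⟦ s ⟧ v ∨ ⟦ t ⟧ v
  ⟦ □ₜ t ⟧ v = □ (⟦ t ⟧ v)
  ⟦ ◇ₜ t ⟧ v = ◇ (⟦ t ⟧ v)
  ⟦ 𝟘ₜ ⟧ v = 𝟘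
  ⟦ 𝟙ₜ ⟧ v = 𝟙

  HoldsAt : (ℕ → Carrier) → Equation → Set
  HoldsAt v (s , t) = ⟦ s ⟧ v ≈ ⟦ t ⟧ v

  Sat : Equation → Set
  Sat e = ∀ v → HoldsAt v e

EqSet : Set₁
EqSet = Equation → Set

_∈𝕍_ : Alg → EqSet → Set
A ∈𝕍 Ax = IsPosS4 A × (∀ e → Ax e → Sat A e)

IdentityOf : EqSet → Equation → Set₁
IdentityOf Ax e = ∀ (A : Alg) → A ∈𝕍 Ax → Sat A e

Subst : Set
Subst = ℕ → Term

_[_] : Term → Subst → Term
var x [ σ ] = σ x
(s ∧ₜ t) [ σ ] = (s [ σ ]) ∧ₜ (t [ σ ])
(s ∨ₜ t) [ σ ] = (s [ σ ]) ∨ₜ (t [ σ ])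
□ₜ t [ σ ] = □ₜ (t [ σ ])
◇ₜ t [ σ ] = ◇ₜ (t [ σ ])
𝟘ₜ [ σ ] = 𝟘ₜ
𝟙ₜ [ σ ] = 𝟙ₜ

substEq : Subst → Equation → Equation
substEq σ (s , t) = (s [ σ ]) , (t [ σ ])

record QuasiEq : Set where
  constructor _⇒_
  field
    premises   : List Equation
    conclusion : Equation

open QuasiEq public

UnifiesPremises : EqSet → QuasiEq → Subst → Set₁
UnifiesPremises Ax q σ = All (λ e → IdentityOf Ax (substEq σ e)) (premises q)

Active : EqSet → QuasiEq → Set₁
Active Ax q = Σ Subst (UnifiesPremises Ax q)

Admissible : EqSet → QuasiEq → Set₁
Admissible Ax q = ∀ σ → UnifiesPremises Ax q σ → IdentityOf Ax (substEq σ (conclusion q))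

ValidIn : EqSet → QuasiEq → Set₁
ValidIn Ax q = ∀ (A : Alg) → A ∈𝕍 Ax → ∀ (v : ℕ → Alg.Carrier A) →
  All (HoldsAt A v) (premises q) → HoldsAt A v (conclusion q)

ActivelyStructurallyComplete : EqSet → Set₁
ActivelyStructurallyComplete Ax = ∀ q → Active Ax q → Admissible Ax q → ValidIn Ax q

-- The three-element chains C₃ᵃ and C₃ᵇ on 0 < a < 1

data Three : Set where
  z a u : Three

meet join : Three → Three → Three
meet z y = z
meet a z = z
meet a y = a
meet u y = y
join z y = y
join a u = u
join a y = a
join u y = u

□ᵃ ◇ᵃ □ᵇ ◇ᵇ : Three → Three
□ᵃ a = z
□ᵃ x = x
◇ᵃ x = x
□ᵇ x = x
◇ᵇ a = u
◇ᵇ x = x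

C3a : Alg
C3a = record { Carrier = Three ; _≈_ = _≡_ ; _∧_ = meet ; _∨_ = join
             ; □ = □ᵃ ; ◇ = ◇ᵃ ; 𝟘 = z ; 𝟙 = u }

C3b : Alg
C3b = record { Carrier = Three ; _≈_ = _≡_ ; _∧_ = meet ; _∨_ = join
             ; □ = □ᵇ ; ◇ = ◇ᵇ ; 𝟘 = z ; 𝟙 = u }

{-# OPTIONS --safe #-}
module Submission where

-- The quasi-equation □x ≈ 0 ⇒ x ≈ 0 is active (take x := 0) and fails in C₃ᵃ at x = a.
-- It is admissible in any variety containing C₃ᵃ: if □σ(x) ≈ 0 is an identity, evaluate σ(x)
-- in C₃ᵃ with every variable sent to 1. Since {0,1} is a subalgebra on which □ and ◇ act as
-- the identity, the value is the two-element evaluation of σ(x) at "all true", so that is 0;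
-- and a term that is 0 there is identically 0 in every positive S4-algebra. Dually for
-- ◇x ≈ 1 ⇒ x ≈ 1 and C₃ᵇ, evaluating at "all false".

open import Defs
open import Function using (_∘_; const)
open import Data.Nat using (ℕ)
open import Data.Product using (_×_; _,_; proj₁; proj₂)
open import Data.Bool using (Bool; true; false) renaming (_∧_ to _&&_; _∨_ to _||_)
open import Data.List using (_∷_; [])
open import Data.List.Relation.Unary.All using (_∷_; [])
open import Relation.Nullary using (¬_)
open import Relation.Binary.PropositionalEquality using (_≡_; refl; sym; trans; cong; cong₂; module ≡-Reasoning)
open import Algebra.Core using (Op₁)
import Algebra.Lattice.Structures as LS

⟦_⟧𝔹 : Term → (ℕ → Bool) → Bool
⟦ var x ⟧𝔹 ρ = ρ x
⟦ s ∧ₜ t ⟧𝔹 ρ = ⟦ s ⟧𝔹 ρ && ⟦ t ⟧𝔹 ρ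
⟦ s ∨ₜ t ⟧𝔹 ρ = ⟦ s ⟧𝔹 ρ || ⟦ t ⟧𝔹 ρ
⟦ □ₜ t ⟧𝔹 ρ = ⟦ t ⟧𝔹 ρ
⟦ ◇ₜ t ⟧𝔹 ρ = ⟦ t ⟧𝔹 ρ
⟦ 𝟘ₜ ⟧𝔹 ρ = false
⟦ 𝟙ₜ ⟧𝔹 ρ = true

module PosS4Properties (A : Alg) (P : IsPosS4 A) where
  open Alg A
  open IsPosS4 P
  open LS.IsDistributiveLattice isDistributiveLattice
    renaming (refl to ≈-refl; sym to ≈-sym; trans to ≈-trans)

  𝟘-∧ : ∀ x → (𝟘 ∧ x) ≈ 𝟘
  𝟘-∧ x = ≈-trans (∧-cong ≈-refl (≈-sym (proj₁ ∨-identity x))) (proj₂ absorptive 𝟘 x)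

  ∧-𝟘 : ∀ x → (x ∧ 𝟘) ≈ 𝟘
  ∧-𝟘 x = ≈-trans (∧-comm x 𝟘) (𝟘-∧ x)

  𝟙-∨ : ∀ x → (𝟙 ∨ x) ≈ 𝟙
  𝟙-∨ x = ≈-trans (∨-cong ≈-refl (≈-sym (proj₁ ∧-identity x))) (proj₁ absorptive 𝟙 x)

  ∨-𝟙 : ∀ x → (x ∨ 𝟙) ≈ 𝟙
  ∨-𝟙 x = ≈-trans (∨-comm x 𝟙) (𝟙-∨ x)

  □-𝟘 : □ 𝟘 ≈ 𝟘
  □-𝟘 = ≈-trans (≈-sym (□-≤ 𝟘)) (∧-𝟘 (□ 𝟘))

  ◇-𝟙 : ◇ 𝟙 ≈ 𝟙
  ◇-𝟙 = ≈-trans (≈-sym (proj₁ ∧-identity (◇ 𝟙))) (≤-◇ 𝟙)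

  ⟦⟧𝔹-true≡false⇒≈𝟘 : ∀ t → ⟦ t ⟧𝔹 (const true) ≡ false → ∀ v → ⟦ A ⟧ t v ≈ 𝟘
  ⟦⟧𝔹-true≡false⇒≈𝟘 (s ∧ₜ t) eq v with ⟦ s ⟧𝔹 (const true) in eqˢ
  ... | false = ≈-trans (∧-cong (⟦⟧𝔹-true≡false⇒≈𝟘 s eqˢ v) ≈-refl) (𝟘-∧ _)
  ... | true  = ≈-trans (∧-cong ≈-refl (⟦⟧𝔹-true≡false⇒≈𝟘 t eq v)) (∧-𝟘 _)
  ⟦⟧𝔹-true≡false⇒≈𝟘 (s ∨ₜ t) eq v with ⟦ s ⟧𝔹 (const true) in eqˢ | ⟦ t ⟧𝔹 (const true) in eqᵗ
  ⟦⟧𝔹-true≡false⇒≈𝟘 (s ∨ₜ t) refl v | false | false =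
    ≈-trans (∨-cong (⟦⟧𝔹-true≡false⇒≈𝟘 s eqˢ v) (⟦⟧𝔹-true≡false⇒≈𝟘 t eqᵗ v)) (proj₁ ∨-identity 𝟘)
  ⟦⟧𝔹-true≡false⇒≈𝟘 (□ₜ t) eq v = ≈-trans (□-cong (⟦⟧𝔹-true≡false⇒≈𝟘 t eq v)) □-𝟘
  ⟦⟧𝔹-true≡false⇒≈𝟘 (◇ₜ t) eq v = ≈-trans (◇-cong (⟦⟧𝔹-true≡false⇒≈𝟘 t eq v)) ◇-𝟘
  ⟦⟧𝔹-true≡false⇒≈𝟘 𝟘ₜ eq v = ≈-refl

  ⟦⟧𝔹-false≡true⇒≈𝟙 : ∀ t → ⟦ t ⟧𝔹 (const false) ≡ true → ∀ v → ⟦ A ⟧ t v ≈ 𝟙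
  ⟦⟧𝔹-false≡true⇒≈𝟙 (s ∧ₜ t) eq v with ⟦ s ⟧𝔹 (const false) in eqˢ | ⟦ t ⟧𝔹 (const false) in eqᵗ
  ⟦⟧𝔹-false≡true⇒≈𝟙 (s ∧ₜ t) refl v | true | true =
    ≈-trans (∧-cong (⟦⟧𝔹-false≡true⇒≈𝟙 s eqˢ v) (⟦⟧𝔹-false≡true⇒≈𝟙 t eqᵗ v)) (proj₁ ∧-identity 𝟙)
  ⟦⟧𝔹-false≡true⇒≈𝟙 (s ∨ₜ t) eq v with ⟦ s ⟧𝔹 (const false) in eqˢ
  ... | true  = ≈-trans (∨-cong (⟦⟧𝔹-false≡true⇒≈𝟙 s eqˢ v) ≈-refl) (𝟙-∨ _)
  ... | false = ≈-trans (∨-cong ≈-refl (⟦⟧𝔹-false≡true⇒≈𝟙 t eq v)) (∨-𝟙 _)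
  ⟦⟧𝔹-false≡true⇒≈𝟙 (□ₜ t) eq v = ≈-trans (□-cong (⟦⟧𝔹-false≡true⇒≈𝟙 t eq v)) □-𝟙
  ⟦⟧𝔹-false≡true⇒≈𝟙 (◇ₜ t) eq v = ≈-trans (◇-cong (⟦⟧𝔹-false≡true⇒≈𝟙 t eq v)) ◇-𝟙
  ⟦⟧𝔹-false≡true⇒≈𝟙 𝟙ₜ eq v = ≈-refl

toThree : Bool → Three
toThree true = u
toThree false = z

meet-toThree : ∀ b c → meet (toThree b) (toThree c) ≡ toThree (b && c)
meet-toThree true  true  = refl
meet-toThree true  false = refl
meet-toThree false _     = refl

join-toThree : ∀ b c → join (toThree b) (toThree c) ≡ toThree (b || c)
join-toThree true  _     = refl
join-toThree false true  = refl
join-toThree false false = refl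

-- C3a and C3b are definitionally chain □ᵃ ◇ᵃ and chain □ᵇ ◇ᵇ.
chain : Op₁ Three → Op₁ Three → Alg
chain □′ ◇′ = record { Carrier = Three ; _≈_ = _≡_ ; _∧_ = meet ; _∨_ = join
                     ; □ = □′ ; ◇ = ◇′ ; 𝟘 = z ; 𝟙 = u }

FixesEnds : Op₁ Three → Set
FixesEnds f = ∀ b → f (toThree b) ≡ toThree b

module _ (□′ ◇′ : Op₁ Three) (fix□ : FixesEnds □′) (fix◇ : FixesEnds ◇′) where

  ⟦chain⟧-toThree : ∀ t ρ → ⟦ chain □′ ◇′ ⟧ t (toThree ∘ ρ) ≡ toThree (⟦ t ⟧𝔹 ρ)
  ⟦chain⟧-toThree (var x) ρ = refl
  ⟦chain⟧-toThree (s ∧ₜ t) ρ =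
    trans (cong₂ meet (⟦chain⟧-toThree s ρ) (⟦chain⟧-toThree t ρ)) (meet-toThree (⟦ s ⟧𝔹 ρ) (⟦ t ⟧𝔹 ρ))
  ⟦chain⟧-toThree (s ∨ₜ t) ρ =
    trans (cong₂ join (⟦chain⟧-toThree s ρ) (⟦chain⟧-toThree t ρ)) (join-toThree (⟦ s ⟧𝔹 ρ) (⟦ t ⟧𝔹 ρ))
  ⟦chain⟧-toThree (□ₜ t) ρ = trans (cong □′ (⟦chain⟧-toThree t ρ)) (fix□ (⟦ t ⟧𝔹 ρ))
  ⟦chain⟧-toThree (◇ₜ t) ρ = trans (cong ◇′ (⟦chain⟧-toThree t ρ)) (fix◇ (⟦ t ⟧𝔹 ρ))
  ⟦chain⟧-toThree 𝟘ₜ ρ = refl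
  ⟦chain⟧-toThree 𝟙ₜ ρ = refl

fixesEnds-□ᵃ : FixesEnds □ᵃ
fixesEnds-□ᵃ true  = refl
fixesEnds-□ᵃ false = refl

fixesEnds-◇ᵃ : FixesEnds ◇ᵃ
fixesEnds-◇ᵃ _ = refl

fixesEnds-□ᵇ : FixesEnds □ᵇ
fixesEnds-□ᵇ _ = refl

fixesEnds-◇ᵇ : FixesEnds ◇ᵇ
fixesEnds-◇ᵇ true  = refl
fixesEnds-◇ᵇ false = refl

□-reflects-𝟘 : QuasiEq
□-reflects-𝟘 = ((□ₜ (var 0) , 𝟘ₜ) ∷ []) ⇒ (var 0 , 𝟘ₜ)

◇-reflects-𝟙 : QuasiEq
◇-reflects-𝟙 = ((◇ₜ (var 0) , 𝟙ₜ) ∷ []) ⇒ (var 0 , 𝟙ₜ)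

active-□-reflects-𝟘 : ∀ Ax → Active Ax □-reflects-𝟘
active-□-reflects-𝟘 Ax = const 𝟘ₜ , (λ A A∈ _ → PosS4Properties.□-𝟘 A (proj₁ A∈)) ∷ []

active-◇-reflects-𝟙 : ∀ Ax → Active Ax ◇-reflects-𝟙
active-◇-reflects-𝟙 Ax = const 𝟙ₜ , (λ A A∈ _ → PosS4Properties.◇-𝟙 A (proj₁ A∈)) ∷ []

toThree≡z⇒false : ∀ {b} → toThree b ≡ z → b ≡ false
toThree≡z⇒false {false} _ = refl

toThree≡u⇒true : ∀ {b} → toThree b ≡ u → b ≡ true
toThree≡u⇒true {true} _ = refl

admissible-□-reflects-𝟘 : ∀ Ax → C3a ∈𝕍 Ax → Admissible Ax □-reflects-𝟘
admissible-□-reflects-𝟘 Ax C3a∈ σ (□σ≈𝟘 ∷ []) A A∈ =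
  PosS4Properties.⟦⟧𝔹-true≡false⇒≈𝟘 A (proj₁ A∈) (σ 0) (toThree≡z⇒false toThree-b≡z)
  where
  open ≡-Reasoning
  b : Bool
  b = ⟦ σ 0 ⟧𝔹 (const true)
  toThree-b≡z : toThree b ≡ z
  toThree-b≡z = begin
    toThree b                         ≡⟨ sym (fixesEnds-□ᵃ b) ⟩
    □ᵃ (toThree b)                    ≡⟨ cong □ᵃ (sym (⟦chain⟧-toThree □ᵃ ◇ᵃ fixesEnds-□ᵃ fixesEnds-◇ᵃ (σ 0) (const true))) ⟩
    □ᵃ (⟦ C3a ⟧ (σ 0) (const u))      ≡⟨ □σ≈𝟘 C3a C3a∈ (const u) ⟩
    z                                 ∎

admissible-◇-reflects-𝟙 : ∀ Ax → C3b ∈𝕍 Ax → Admissible Ax ◇-reflects-𝟙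
admissible-◇-reflects-𝟙 Ax C3b∈ σ (◇σ≈𝟙 ∷ []) A A∈ =
  PosS4Properties.⟦⟧𝔹-false≡true⇒≈𝟙 A (proj₁ A∈) (σ 0) (toThree≡u⇒true toThree-b≡u)
  where
  open ≡-Reasoning
  b : Bool
  b = ⟦ σ 0 ⟧𝔹 (const false)
  toThree-b≡u : toThree b ≡ u
  toThree-b≡u = begin
    toThree b                         ≡⟨ sym (fixesEnds-◇ᵇ b) ⟩
    ◇ᵇ (toThree b)                    ≡⟨ cong ◇ᵇ (sym (⟦chain⟧-toThree □ᵇ ◇ᵇ fixesEnds-□ᵇ fixesEnds-◇ᵇ (σ 0) (const false))) ⟩
    ◇ᵇ (⟦ C3b ⟧ (σ 0) (const z))      ≡⟨ ◇σ≈𝟙 C3b C3b∈ (const z) ⟩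
    u                                 ∎

C3a-refutes-□-reflects-𝟘 : ∀ Ax → C3a ∈𝕍 Ax → ¬ ValidIn Ax □-reflects-𝟘
C3a-refutes-□-reflects-𝟘 Ax C3a∈ valid with valid C3a C3a∈ (const a) (refl ∷ [])
... | ()

C3b-refutes-◇-reflects-𝟙 : ∀ Ax → C3b ∈𝕍 Ax → ¬ ValidIn Ax ◇-reflects-𝟙
C3b-refutes-◇-reflects-𝟙 Ax C3b∈ valid with valid C3b C3b∈ (const a) (refl ∷ [])
... | ()

lemma9p4 : (Ax : EqSet) → ActivelyStructurallyComplete Ax →
    (¬ (C3a ∈𝕍 Ax)) × (¬ (C3b ∈𝕍 Ax))
lemma9p4 Ax asc = C3a∉ , C3b∉
  where
  C3a∉ : ¬ (C3a ∈𝕍 Ax)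
  C3a∉ C3a∈ = C3a-refutes-□-reflects-𝟘 Ax C3a∈
    (asc □-reflects-𝟘 (active-□-reflects-𝟘 Ax) (admissible-□-reflects-𝟘 Ax C3a∈))
  C3b∉ : ¬ (C3b ∈𝕍 Ax)
  C3b∉ C3b∈ = C3b-refutes-◇-reflects-𝟙 Ax C3b∈
    (asc ◇-reflects-𝟙 (active-◇-reflects-𝟙 Ax) (admissible-◇-reflects-𝟙 Ax C3b∈))
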